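{- For every integer $d \geq 1$, $b(d+1) \geq 2b(d) + 2$, where $b(d)$ is the maximum cardinality of a minimal edge cover of degree $d$ of a complete bipartite graph.
   Context: For a finite graph $G$, a family of subsets of $V(G)$ is an edge cover of $G$ iff every edge of $G$ is included in some member; it is a minimal edge cover iff no proper subfamily is an edge cover; it has degree $d$ if every vertex lies in at most $d$ members. -}

module Defs where

open import Data.Nat using (ℕ; zero; suc; _≤_; _<_)
open import Data.Fin using (Fin)
open import Data.Sum using (_⊎_; inj₁; inj₂)
open import Data.Bool using (Bool; true; false)
open import Data.List using (List; []; _∷_; length)
open import Data.List.Relation.Unary.Any using (Any)
open import Data.List.Relation.Binary.Sublist.Propositional using (_⊆_)
open import Data.Product using (_×_; Σ; ∃)
open import Relation.Binary.PropositionalEquality using (_≡_)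
open import Relation.Nullary using (¬_)

-- Vertices of the complete bipartite graph K_{m,n}: left part Fin m, right part Fin n.
-- Edges are exactly the pairs {inj₁ i , inj₂ j}.
Vertex : ℕ → ℕ → Set
Vertex m n = Fin m ⊎ Fin n

VSubset : ℕ → ℕ → Set
VSubset m n = Vertex m n → Bool

-- A family of subsets, as a list; its cardinality is its length.
-- (Minimal covers never contain repeated members, so the list-length is the
-- cardinality of the family.)
Family : ℕ → ℕ → Set
Family m n = List (VSubset m n)

IsEdgeCover : ∀ {m n} → Family m n → Set
IsEdgeCover {m} {n} F =
  (i : Fin m) (j : Fin n) → Any (λ S → (S (inj₁ i) ≡ true) × (S (inj₂ j) ≡ true)) F

IsMinimalEdgeCover : ∀ {m n} → Family m n → Set
IsMinimalEdgeCover {m} {n} F =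
  IsEdgeCover F ×
  ((F' : Family m n) → F' ⊆ F → length F' < length F → ¬ IsEdgeCover F')

memberCount : ∀ {m n} → Vertex m n → Family m n → ℕ
memberCount v [] = 0
memberCount v (S ∷ F) with S v
... | true  = suc (memberCount v F)
... | false = memberCount v F

HasDegree : ∀ {m n} → ℕ → Family m n → Set
HasDegree {m} {n} d F = (v : Vertex m n) → memberCount v F ≤ d

IsMaxMinCoverSize : ℕ → ℕ → Set
IsMaxMinCoverSize d b =
  (Σ ℕ λ m → Σ ℕ λ n → Σ (Family m n) λ F →
     IsMinimalEdgeCover F × HasDegree d F × length F ≡ b)
  × ((m n : ℕ) (F : Family m n) →
       IsMinimalEdgeCover F → HasDegree d F → length F ≤ b)

{-# OPTIONS --safe #-}
-- Since the whole vertex set of K₁,₁ is a minimal cover of degree 1 ≤ d,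
-- b(d) ≥ 1, so a minimal cover F of K_{m,n} of degree d and size b(d) exists with
-- m, n ≥ 1.  Place one copy of F on parts L₁, R₁ and another on L₂, R₂ of K_{2m,2n}
-- and add the two sets L₁ ∪ R₂ and L₂ ∪ R₁.  Every vertex lies in exactly one of the
-- new sets, so the degree is d + 1.  The result is a minimal cover of size 2b(d) + 2:
-- each new set is the only member meeting the edges between its two parts, and a
-- covering subfamily must restrict to a cover of each copy, so by minimality of F it
-- keeps both copies entirely.
module Submission where

open import Defs
open import Data.Nat using (ℕ; suc; _≤_; _<_; _+_; _*_; s≤s)
open import Data.Nat.Properties using (≮⇒≥; <⇒≱; +-mono-≤; +-identityʳ; +-comm; module ≤-Reasoning)
open import Data.Fin using (Fin; zero)
open import Data.Fin.Properties using (+↔⊎)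
open import Data.Sum using (_⊎_; inj₁; inj₂; [_,_]′; reduce)
import Data.Sum as Sum
open import Data.Bool using (Bool; true; false; if_then_else_)
open import Data.List using (List; []; _∷_; [_]; length; map; _++_)
open import Data.List.Properties using (length-map; length-++)
open import Data.List.Relation.Unary.Any using (Any; here; there; satisfied)
import Data.List.Relation.Unary.Any.Properties as Any
open import Data.List.Relation.Binary.Sublist.Propositional using (_⊆_; []; _∷_; _∷ʳ_; minimum; lookup)
open import Data.Product using (_×_; _,_; proj₁; proj₂; ∃; ∃₂)
open import Data.Empty using (⊥-elim)
open import Function using (_∘_)
open import Function.Bundles using (_↠_; Surjection)
open import Function.Properties.Inverse using (↔⇒↠)
open import Relation.Binary.PropositionalEquality using (_≡_; refl; trans; cong; cong₂; module ≡-Reasoning)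
open import Relation.Nullary using (¬_)

¬Any-of-empty : ∀ {A : Set} {P : A → Set} {xs : List A} → (∀ {x} → ¬ P x) → ¬ Any P xs
¬Any-of-empty ¬P = ¬P ∘ proj₂ ∘ satisfied

⊆-++⁻ : ∀ {A : Set} (xs : List A) {ys zs : List A} → zs ⊆ xs ++ ys →
        ∃₂ λ xs′ ys′ → xs′ ⊆ xs × ys′ ⊆ ys × zs ≡ xs′ ++ ys′
⊆-++⁻ [] τ = [] , _ , [] , τ , refl
⊆-++⁻ (x ∷ xs) (_ ∷ʳ τ) with ⊆-++⁻ xs τ
... | xs′ , ys′ , σ , ρ , refl = xs′ , ys′ , x ∷ʳ σ , ρ , refl
⊆-++⁻ (x ∷ xs) (refl ∷ τ) with ⊆-++⁻ xs τ
... | xs′ , ys′ , σ , ρ , refl = x ∷ xs′ , ys′ , refl ∷ σ , ρ , refl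

⊆-map⁻ : ∀ {A B : Set} (f : A → B) (xs : List A) {ys : List B} → ys ⊆ map f xs →
         ∃ λ xs′ → xs′ ⊆ xs × ys ≡ map f xs′
⊆-map⁻ f [] [] = [] , [] , refl
⊆-map⁻ f (x ∷ xs) (_ ∷ʳ τ) with ⊆-map⁻ f xs τ
... | xs′ , σ , refl = xs′ , x ∷ʳ σ , refl
⊆-map⁻ f (x ∷ xs) (refl ∷ τ) with ⊆-map⁻ f xs τ
... | xs′ , σ , refl = x ∷ xs′ , refl ∷ σ , refl

module _ {V : Set} where

  degree : V → List (V → Bool) → ℕ
  degree v []      = 0
  degree v (S ∷ F) = if S v then suc (degree v F) else degree v F

  degree-++ : ∀ v (F G : List (V → Bool)) → degree v (F ++ G) ≡ degree v F + degree v G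
  degree-++ v []      G = refl
  degree-++ v (S ∷ F) G with S v
  ... | true  = cong suc (degree-++ v F G)
  ... | false = degree-++ v F G

module _ {V W : Set} (f : (V → Bool) → (W → Bool)) {w : W} where

  degree-map : ∀ {v} → (∀ S → f S w ≡ S v) → ∀ F → degree w (map f F) ≡ degree v F
  degree-map eq []      = refl
  degree-map eq (S ∷ F) rewrite eq S | degree-map eq F = refl

  degree-map-false : (∀ S → f S w ≡ false) → ∀ F → degree w (map f F) ≡ 0
  degree-map-false eq []      = refl
  degree-map-false eq (S ∷ F) rewrite eq S = degree-map-false eq F

memberCount≡degree : ∀ {m n} (v : Vertex m n) (F : Family m n) → memberCount v F ≡ degree v F
memberCount≡degree v []      = refl
memberCount≡degree v (S ∷ F) with S v
... | true  = cong suc (memberCount≡degree v F)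
... | false = memberCount≡degree v F

-- IsEdgeCover and IsMinimalEdgeCover are, definitionally, the instances X = Fin m, Y = Fin n.
module _ {X Y : Set} where

  CoversEdge : (X ⊎ Y → Bool) → X → Y → Set
  CoversEdge S x y = (S (inj₁ x) ≡ true) × (S (inj₂ y) ≡ true)

  Covers : List (X ⊎ Y → Bool) → Set
  Covers F = (x : X) (y : Y) → Any (λ S → CoversEdge S x y) F

  IsMinimalCover : List (X ⊎ Y → Bool) → Set
  IsMinimalCover F = Covers F × ((F′ : List (X ⊎ Y → Bool)) → F′ ⊆ F → length F′ < length F → ¬ Covers F′)

  minimalCover⇒length≤ : ∀ {F F′} → IsMinimalCover F → F′ ⊆ F → Covers F′ → length F ≤ length F′
  minimalCover⇒length≤ (_ , minimal) τ cov = ≮⇒≥ λ shorter → minimal _ τ shorter cov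

  length≤⇒minimalCover : ∀ {F} → Covers F →
    (∀ {F′} → F′ ⊆ F → Covers F′ → length F ≤ length F′) → IsMinimalCover F
  length≤⇒minimalCover cov length≤ = cov , λ _ τ shorter cov′ → <⇒≱ shorter (length≤ τ cov′)

module _ {X Y X′ Y′ : Set} (f : X′ ↠ X) (g : Y′ ↠ Y) where
  open Surjection using (to; strictlySurjective)

  relabel : List (X ⊎ Y → Bool) → List (X′ ⊎ Y′ → Bool)
  relabel = map (_∘ Sum.map (to f) (to g))

  relabel-covers : ∀ {F} → Covers F → Covers (relabel F)
  relabel-covers cov x y = Any.map⁺ (cov (to f x) (to g y))

  relabel-covers⁻ : ∀ {F} → Covers (relabel F) → Covers F
  relabel-covers⁻ cov x y with strictlySurjective f x | strictlySurjective g y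
  ... | x′ , refl | y′ , refl = Any.map⁻ (cov x′ y′)

  relabel-minimal : ∀ {F} → IsMinimalCover F → IsMinimalCover (relabel F)
  relabel-minimal {F} minF = length≤⇒minimalCover (relabel-covers (proj₁ minF)) length≤
    where
    open ≤-Reasoning
    length≤ : ∀ {F′} → F′ ⊆ relabel F → Covers F′ → length (relabel F) ≤ length F′
    length≤ τ cov with ⊆-map⁻ _ F τ
    ... | F₀ , τ₀ , refl = begin
      length (relabel F)  ≡⟨ length-map _ F ⟩
      length F            ≤⟨ minimalCover⇒length≤ minF τ₀ (relabel-covers⁻ cov) ⟩
      length F₀           ≡⟨ length-map _ F₀ ⟨
      length (relabel F₀) ∎

  degree-relabel : ∀ F v → degree v (relabel F) ≡ degree (Sum.map (to f) (to g) v) F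
  degree-relabel F v = degree-map _ (λ _ → refl) F

module _ {X Y : Set} where

  private
    Doubled : Set
    Doubled = (X ⊎ X) ⊎ (Y ⊎ Y)

  bridge₁₂ bridge₂₁ : Doubled → Bool
  bridge₁₂ (inj₁ (inj₁ _)) = true
  bridge₁₂ (inj₂ (inj₂ _)) = true
  bridge₁₂ _               = false
  bridge₂₁ (inj₁ (inj₂ _)) = true
  bridge₂₁ (inj₂ (inj₁ _)) = true
  bridge₂₁ _               = false

  copy₁ copy₂ : (X ⊎ Y → Bool) → Doubled → Bool
  copy₁ S (inj₁ (inj₁ x)) = S (inj₁ x)
  copy₁ S (inj₂ (inj₁ y)) = S (inj₂ y)
  copy₁ S _               = false
  copy₂ S (inj₁ (inj₂ x)) = S (inj₁ x)
  copy₂ S (inj₂ (inj₂ y)) = S (inj₂ y)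
  copy₂ S _               = false

  copies : List (X ⊎ Y → Bool) → List (X ⊎ Y → Bool) → List (Doubled → Bool)
  copies F₁ F₂ = map copy₁ F₁ ++ map copy₂ F₂

  double : List (X ⊎ Y → Bool) → List (Doubled → Bool)
  double F = bridge₁₂ ∷ bridge₂₁ ∷ copies F F

  collapse : Doubled → X ⊎ Y
  collapse = Sum.map reduce reduce

  length-copies : ∀ F₁ F₂ → length (copies F₁ F₂) ≡ length F₁ + length F₂
  length-copies F₁ F₂ = trans (length-++ (map copy₁ F₁)) (cong₂ _+_ (length-map copy₁ F₁) (length-map copy₂ F₂))

  length-double : ∀ F → length (double F) ≡ 2 * length F + 2
  length-double F = begin
    2 + length (copies F F)   ≡⟨ cong (2 +_) (length-copies F F) ⟩
    2 + (length F + length F) ≡⟨ cong (λ k → 2 + (length F + k)) (+-identityʳ (length F)) ⟨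
    2 + 2 * length F          ≡⟨ +-comm 2 (2 * length F) ⟩
    2 * length F + 2          ∎
    where open ≡-Reasoning

  degree-bridges : ∀ v G → degree v (bridge₁₂ ∷ bridge₂₁ ∷ G) ≡ suc (degree v G)
  degree-bridges (inj₁ (inj₁ _)) G = refl
  degree-bridges (inj₁ (inj₂ _)) G = refl
  degree-bridges (inj₂ (inj₁ _)) G = refl
  degree-bridges (inj₂ (inj₂ _)) G = refl

  degree-copies : ∀ F v → degree v (copies F F) ≡ degree (collapse v) F
  degree-copies F v = trans (degree-++ v (map copy₁ F) (map copy₂ F)) (split v)
    where
    split : ∀ v → degree v (map copy₁ F) + degree v (map copy₂ F) ≡ degree (collapse v) F
    split (inj₁ (inj₁ x)) = trans (cong₂ _+_ (degree-map copy₁ (λ _ → refl) F)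
                                             (degree-map-false copy₂ (λ _ → refl) F)) (+-identityʳ _)
    split (inj₂ (inj₁ y)) = trans (cong₂ _+_ (degree-map copy₁ (λ _ → refl) F)
                                             (degree-map-false copy₂ (λ _ → refl) F)) (+-identityʳ _)
    split (inj₁ (inj₂ x)) = cong₂ _+_ (degree-map-false copy₁ (λ _ → refl) F) (degree-map copy₂ (λ _ → refl) F)
    split (inj₂ (inj₂ y)) = cong₂ _+_ (degree-map-false copy₁ (λ _ → refl) F) (degree-map copy₂ (λ _ → refl) F)

  degree-double : ∀ F v → degree v (double F) ≡ suc (degree (collapse v) F)
  degree-double F v = trans (degree-bridges v (copies F F)) (cong suc (degree-copies F v))

  double-covers : ∀ {F} → Covers F → Covers (double F)
  double-covers     cov (inj₁ x) (inj₁ y) = there (there (Any.++⁺ˡ (Any.map⁺ (cov x y))))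
  double-covers     cov (inj₁ x) (inj₂ y) = here (refl , refl)
  double-covers     cov (inj₂ x) (inj₁ y) = there (here (refl , refl))
  double-covers {F} cov (inj₂ x) (inj₂ y) = there (there (Any.++⁺ʳ (map copy₁ F) (Any.map⁺ (cov x y))))

  copies-miss₁₂ : ∀ {F₁ F₂ x y} → ¬ Any (λ T → CoversEdge T (inj₁ x) (inj₂ y)) (copies F₁ F₂)
  copies-miss₁₂ {F₁} a = [ ¬Any-of-empty (λ { (_ , ()) }) ∘ Any.map⁻ , ¬Any-of-empty (λ { (() , _) }) ∘ Any.map⁻ ]′
                           (Any.++⁻ (map copy₁ F₁) a)

  copies-miss₂₁ : ∀ {F₁ F₂ x y} → ¬ Any (λ T → CoversEdge T (inj₂ x) (inj₁ y)) (copies F₁ F₂)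
  copies-miss₂₁ {F₁} a = [ ¬Any-of-empty (λ { (() , _) }) ∘ Any.map⁻ , ¬Any-of-empty (λ { (_ , ()) }) ∘ Any.map⁻ ]′
                           (Any.++⁻ (map copy₁ F₁) a)

  copies-⊆⁻ : ∀ {F₁ F₂ G} → G ⊆ copies F₁ F₂ →
              ∃₂ λ F₁′ F₂′ → F₁′ ⊆ F₁ × F₂′ ⊆ F₂ × G ≡ copies F₁′ F₂′
  copies-⊆⁻ {F₁} {F₂} τ with ⊆-++⁻ (map copy₁ F₁) τ
  ... | G₁ , G₂ , σ₁ , σ₂ , refl with ⊆-map⁻ copy₁ F₁ σ₁ | ⊆-map⁻ copy₂ F₂ σ₂
  ... | F₁′ , τ₁ , refl | F₂′ , τ₂ , refl = F₁′ , F₂′ , τ₁ , τ₂ , refl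

  copies-covers⁻ : ∀ {F₁ F₂} → Covers (bridge₁₂ ∷ bridge₂₁ ∷ copies F₁ F₂) → Covers F₁ × Covers F₂
  copies-covers⁻ {F₁} {F₂} cov = (λ x y → first (cov (inj₁ x) (inj₁ y))) , (λ x y → second (cov (inj₂ x) (inj₂ y)))
    where
    first : ∀ {x y} → Any (λ T → CoversEdge T (inj₁ x) (inj₁ y)) (bridge₁₂ ∷ bridge₂₁ ∷ copies F₁ F₂) →
            Any (λ S → CoversEdge S x y) F₁
    first (here (_ , ()))
    first (there (here (() , _)))
    first (there (there a)) =
      [ Any.map⁻ , ⊥-elim ∘ ¬Any-of-empty (λ { (() , _) }) ∘ Any.map⁻ ]′ (Any.++⁻ (map copy₁ F₁) a)

    second : ∀ {x y} → Any (λ T → CoversEdge T (inj₂ x) (inj₂ y)) (bridge₁₂ ∷ bridge₂₁ ∷ copies F₁ F₂) →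
             Any (λ S → CoversEdge S x y) F₂
    second (here (() , _))
    second (there (here (_ , ())))
    second (there (there a)) =
      [ ⊥-elim ∘ ¬Any-of-empty (λ { (() , _) }) ∘ Any.map⁻ , Any.map⁻ ]′ (Any.++⁻ (map copy₁ F₁) a)

  double-length≤ : ∀ {F G} → X → Y → IsMinimalCover F → G ⊆ double F → Covers G →
                   length (double F) ≤ length G
  double-length≤ {F} x y _ (_ ∷ʳ τ) cov with lookup τ (cov (inj₁ x) (inj₂ y))
  ... | here (() , _)
  ... | there a = ⊥-elim (copies-miss₁₂ {F} {F} a)
  double-length≤ {F} x y _ (refl ∷ (_ ∷ʳ τ)) cov with cov (inj₂ x) (inj₁ y)
  ... | here (() , _)
  ... | there a = ⊥-elim (copies-miss₂₁ {F} {F} (lookup τ a))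
  double-length≤ {F} _ _ minF (refl ∷ (refl ∷ τ)) cov with copies-⊆⁻ τ
  ... | F₁ , F₂ , τ₁ , τ₂ , refl = s≤s (s≤s (begin
    length (copies F F)   ≡⟨ length-copies F F ⟩
    length F + length F   ≤⟨ +-mono-≤ (minimalCover⇒length≤ minF τ₁ cov₁) (minimalCover⇒length≤ minF τ₂ cov₂) ⟩
    length F₁ + length F₂ ≡⟨ length-copies F₁ F₂ ⟨
    length (copies F₁ F₂) ∎))
    where
    open ≤-Reasoning
    cov₁ : Covers F₁
    cov₁ = proj₁ (copies-covers⁻ cov)
    cov₂ : Covers F₂
    cov₂ = proj₂ (copies-covers⁻ cov)

  double-minimal : ∀ {F} → X → Y → IsMinimalCover F → IsMinimalCover (double F)
  double-minimal x y minF = length≤⇒minimalCover (double-covers (proj₁ minF)) (double-length≤ x y minF)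

minimal-nonempty⇒edge : ∀ {m n} {F : Family m n} → IsMinimalEdgeCover F → 0 < length F → Fin m × Fin n
minimal-nonempty⇒edge {0}             (_ , minimal) nonempty = ⊥-elim (minimal [] (minimum _) nonempty λ ())
minimal-nonempty⇒edge {suc _} {0}     (_ , minimal) nonempty = ⊥-elim (minimal [] (minimum _) nonempty λ _ ())
minimal-nonempty⇒edge {suc _} {suc _} _             _        = zero , zero

vertexSetCover : Family 1 1
vertexSetCover = [ (λ _ → true) ]

vertexSetCover-minimal : IsMinimalEdgeCover vertexSetCover
vertexSetCover-minimal = (λ { zero zero → here (refl , refl) }) , λ where
  []      _ _         cov → Any.¬Any[] (cov zero zero)
  (_ ∷ _) _ (s≤s ())  _

vertexSetCover-degree : ∀ {d} → 1 ≤ d → HasDegree d vertexSetCover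
vertexSetCover-degree 1≤d (inj₁ _) = 1≤d
vertexSetCover-degree 1≤d (inj₂ _) = 1≤d

halves : ∀ {m} → Fin (m + m) ↠ (Fin m ⊎ Fin m)
halves = ↔⇒↠ +↔⊎

doubleEdgeCover : ∀ {m n} → Family m n → Family (m + m) (n + n)
doubleEdgeCover = relabel halves halves ∘ double

doubleEdgeCover-minimal : ∀ {m n} {F : Family m n} → Fin m × Fin n →
  IsMinimalEdgeCover F → IsMinimalEdgeCover (doubleEdgeCover F)
doubleEdgeCover-minimal (i , j) minF = relabel-minimal halves halves (double-minimal i j minF)

doubleEdgeCover-degree : ∀ {m n d} {F : Family m n} → HasDegree d F → HasDegree (suc d) (doubleEdgeCover F)
doubleEdgeCover-degree {m} {n} {d} {F} degF v = begin
  memberCount v (doubleEdgeCover F) ≡⟨ memberCount≡degree v (doubleEdgeCover F) ⟩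
  degree v (doubleEdgeCover F)      ≡⟨ degree-relabel halves halves (double F) v ⟩
  degree w (double F)               ≡⟨ degree-double F w ⟩
  suc (degree (collapse w) F)       ≡⟨ cong suc (memberCount≡degree (collapse w) F) ⟨
  suc (memberCount (collapse w) F)  ≤⟨ s≤s (degF (collapse w)) ⟩
  suc d                             ∎
  where
  open ≤-Reasoning
  w : (Fin m ⊎ Fin m) ⊎ (Fin n ⊎ Fin n)
  w = Sum.map (Surjection.to halves) (Surjection.to halves) v

length-doubleEdgeCover : ∀ {m n} (F : Family m n) → length (doubleEdgeCover F) ≡ 2 * length F + 2
length-doubleEdgeCover F = trans (length-map _ (double F)) (length-double F)

theorem3p2 : (d : ℕ) → 1 ≤ d → (b₁ b₂ : ℕ) →
    IsMaxMinCoverSize d b₁ → IsMaxMinCoverSize (suc d) b₂ →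
    2 * b₁ + 2 ≤ b₂
theorem3p2 d 1≤d b₁ b₂ ((m , n , F , minF , degF , refl) , maximal₁) (_ , maximal₂) = begin
  2 * length F + 2           ≡⟨ length-doubleEdgeCover F ⟨
  length (doubleEdgeCover F) ≤⟨ maximal₂ _ _ (doubleEdgeCover F) (doubleEdgeCover-minimal {F = F} edge minF)
                                                                  (doubleEdgeCover-degree {F = F} degF) ⟩
  b₂                         ∎
  where
  open ≤-Reasoning
  edge : Fin m × Fin n
  edge = minimal-nonempty⇒edge minF
           (maximal₁ 1 1 vertexSetCover vertexSetCover-minimal (vertexSetCover-degree 1≤d))
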